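{- Let $\mathbf{L}$ be a Euclidean modal logic. If $\{2\}\times\mathbf{N}^{ - }\subseteq\mathtt{S}_{\mathbf{L}}$, then $\mathtt{Th}(\mathtt{Fr}(\mathbf{L}))$ is contained in the first-order theory of $\mathcal{K}_2$ (the set of first-order sentences valid in every frame of $\mathcal{K}_2$).
   Context: A frame is a pair $(W,R)$ with $W$ non-empty and $R\subseteq W\times W$. Modal formulas are built from propositional variables, $\bot$, $\neg$, $\vee$, $\Box$ with Kripke semantics; validity means truth at every point under every valuation. A (normal) modal logic is a set of modal formulas containing all tautologies and all instances of $\Box(\varphi\to\psi)\to(\Box\varphi\to\Box\psi)$, closed under uniform substitution, modus ponens and necessitation; consistent means not containing $\bot$. A Euclidean modal logic is a consistent modal logic containing $\Diamond\varphi\to\Box\Diamond\varphi$ for all $\varphi$. $\mathtt{Fr}(\mathbf{L})$ is the class of frames validating $\mathbf{L}$; $\mathtt{Th}(\mathcal{C})$ is the set of first-order sentences (with equality and one binary relation symbol) valid in every frame of $\mathcal{C}$. For disjoint sets $A,B$ with $A\cup B\neq\emptyset$ and $\rho:A\to\mathcal{P}(B)$, the galaxy $\mathcal{F}^\rho_{A,B}$ is the frame with universe $A\cup B$ and relation $\bigcup_{s\in A}(\{s\}\times\rho(s))\cup(B\times B)$. $\mathcal{K}_2$ is the class of galaxies with $|A|\geq4$, $|B|\geq4$ and $|\rho(s)|=2$ for all $s\in A$. $\mathbf{N}^{+}=\mathbb{N}\setminus\{0\}$, $\mathbf{N}^{ - }=\mathbb{N}\cup\{ -1\}$. For $m\in\mathbf{N}^{+}$,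 $n\in\mathbf{N}^{ - }$ the flower $\mathcal{F}_m^n$ is: if $n\in\mathbb{N}$, universe $\{0,\dots,m+n\}$ with relation $(\{0\}\times\{1,\dots,m\})\cup(\{1,\dots,m+n\}\times\{1,\dots,m+n\})$; if $n=-1$, universe $\{1,\dots,m\}$ with the universal relation. $\mathtt{S}_{\mathbf{L}}=\{(m,n)\in\mathbf{N}^{+}\times\mathbf{N}^{ - }:\mathcal{F}_m^n\text{ validates }\mathbf{L}\}$. -}

module Defs where

open import Level using (0ℓ)
open import Data.Nat using (ℕ; zero; suc; _+_; _≤_)
open import Data.Fin using (Fin; toℕ) renaming (zero to fz; suc to fs)
open import Data.Bool using (Bool; true; false; not; _∨_)
open import Data.Product using (Σ; ∃; _×_; _,_)
open import Data.Sum using (_⊎_; inj₁; inj₂)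
open import Data.Empty using (⊥)
open import Data.Unit using (⊤)
open import Relation.Nullary using (¬_)
open import Relation.Binary.PropositionalEquality using (_≡_; _≢_)
open import Function.Bundles using (_↣_)

data Fm : Set where
  var  : ℕ → Fm
  ⊥ₘ   : Fm
  ¬ₘ_  : Fm → Fm
  _∨ₘ_ : Fm → Fm → Fm
  □_   : Fm → Fm

infixr 6 _∨ₘ_
infixr 5 _⇒ₘ_

_⇒ₘ_ : Fm → Fm → Fm
φ ⇒ₘ ψ = (¬ₘ φ) ∨ₘ ψ

◇_ : Fm → Fm
◇ φ = ¬ₘ (□ (¬ₘ φ))

sub : (ℕ → Fm) → Fm → Fm
sub σ (var i)  = σ i
sub σ ⊥ₘ       = ⊥ₘ
sub σ (¬ₘ φ)   = ¬ₘ sub σ φ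
sub σ (φ ∨ₘ ψ) = sub σ φ ∨ₘ sub σ ψ
sub σ (□ φ)    = □ sub σ φ

evalB : (ℕ → Bool) → (Fm → Bool) → Fm → Bool
evalB v b (var i)  = v i
evalB v b ⊥ₘ       = false
evalB v b (¬ₘ φ)   = not (evalB v b φ)
evalB v b (φ ∨ₘ ψ) = evalB v b φ ∨ evalB v b ψ
evalB v b (□ φ)    = b φ

-- φ is a tautology (a substitution instance of a propositional tautology)
Tautology : Fm → Set
Tautology φ = (v : ℕ → Bool) (b : Fm → Bool) → evalB v b φ ≡ true

record ModalLogic (L : Fm → Set) : Set where
  field
    taut : ∀ φ → Tautology φ → L φ
    K    : ∀ φ ψ → L (□ (φ ⇒ₘ ψ) ⇒ₘ (□ φ ⇒ₘ □ ψ))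
    usub : ∀ (σ : ℕ → Fm) φ → L φ → L (sub σ φ)
    mp   : ∀ φ ψ → L φ → L (φ ⇒ₘ ψ) → L ψ
    nec  : ∀ φ → L φ → L (□ φ)

Consistent : (Fm → Set) → Set
Consistent L = ¬ L ⊥ₘ

record EuclideanLogic (L : Fm → Set) : Set where
  field
    modal      : ModalLogic L
    consistent : Consistent L
    euclid     : ∀ φ → L (◇ φ ⇒ₘ □ (◇ φ))

record Frame : Set₁ where
  field
    W : Set
    R : W → W → Set

open Frame public

NonEmpty : Frame → Set
NonEmpty F = W F

Sat : (F : Frame) → (ℕ → W F → Set) → W F → Fm → Set
Sat F V w (var i)  = V i w
Sat F V w ⊥ₘ       = ⊥
Sat F V w (¬ₘ φ)   = ¬ Sat F V w φ
Sat F V w (φ ∨ₘ ψ) = Sat F V w φ ⊎ Sat F V w ψ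
Sat F V w (□ φ)    = ∀ u → R F w u → Sat F V u φ

Valid : Frame → Fm → Set₁
Valid F φ = ∀ (V : ℕ → W F → Set) (w : W F) → Sat F V w φ

Validates : Frame → (Fm → Set) → Set₁
Validates F L = ∀ φ → L φ → Valid F φ

Fr : (Fm → Set) → Frame → Set₁
Fr L F = Level.Lift (Level.suc 0ℓ) (NonEmpty F) × Validates F L

data FOFm : ℕ → Set where
  _≐_  : ∀ {n} → Fin n → Fin n → FOFm n
  rel  : ∀ {n} → Fin n → Fin n → FOFm n
  ⊥ᶠ   : ∀ {n} → FOFm n
  ¬ᶠ_  : ∀ {n} → FOFm n → FOFm n
  _∧ᶠ_ : ∀ {n} → FOFm n → FOFm n → FOFm n
  _∨ᶠ_ : ∀ {n} → FOFm n → FOFm n → FOFm n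
  _⇒ᶠ_ : ∀ {n} → FOFm n → FOFm n → FOFm n
  ∀ᶠ   : ∀ {n} → FOFm (suc n) → FOFm n
  ∃ᶠ   : ∀ {n} → FOFm (suc n) → FOFm n

Sentence : Set
Sentence = FOFm 0

extend : ∀ {n} {X : Set} → X → (Fin n → X) → Fin (suc n) → X
extend d ρ fz     = d
extend d ρ (fs i) = ρ i

SatFO : (F : Frame) → ∀ {n} → (Fin n → W F) → FOFm n → Set
SatFO F ρ (i ≐ j)   = ρ i ≡ ρ j
SatFO F ρ (rel i j) = R F (ρ i) (ρ j)
SatFO F ρ ⊥ᶠ        = ⊥
SatFO F ρ (¬ᶠ φ)    = ¬ SatFO F ρ φ
SatFO F ρ (φ ∧ᶠ ψ)  = SatFO F ρ φ × SatFO F ρ ψ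
SatFO F ρ (φ ∨ᶠ ψ)  = SatFO F ρ φ ⊎ SatFO F ρ ψ
SatFO F ρ (φ ⇒ᶠ ψ)  = SatFO F ρ φ → SatFO F ρ ψ
SatFO F ρ (∀ᶠ φ)    = ∀ (d : W F) → SatFO F (extend d ρ) φ
SatFO F ρ (∃ᶠ φ)    = Σ (W F) λ d → SatFO F (extend d ρ) φ

noVars : {X : Set} → Fin 0 → X
noVars ()

_⊨_ : Frame → Sentence → Set
F ⊨ σ = SatFO F noVars σ

Th : (Frame → Set₁) → Sentence → Set₁
Th C σ = ∀ (F : Frame) → C F → F ⊨ σ


-- Galaxies.  Disjoint A, B are realised as the disjoint union A ⊎ B;
-- ρ(s) ⊆ B is a predicate on B.

galaxy : (A B : Set) → (A → B → Set) → Frame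
galaxy A B ρ = record { W = A ⊎ B ; R = rel' }
  where
  rel' : A ⊎ B → A ⊎ B → Set
  rel' (inj₁ s) (inj₁ _) = ⊥
  rel' (inj₁ s) (inj₂ b) = ρ s b
  rel' (inj₂ _) (inj₁ _) = ⊥
  rel' (inj₂ _) (inj₂ _) = ⊤

AtLeast4 : Set → Set
AtLeast4 X = Fin 4 ↣ X

ExactlyTwo : {B : Set} → (B → Set) → Set
ExactlyTwo {B} P = Σ B λ b₁ → Σ B λ b₂ →
  b₁ ≢ b₂ × P b₁ × P b₂ × (∀ b → P b → b ≡ b₁ ⊎ b ≡ b₂)

K₂ : Frame → Set₁
K₂ F = Σ Set λ A → Σ Set λ B → Σ (A → B → Set) λ ρ →
  AtLeast4 A × AtLeast4 B × (∀ s → ExactlyTwo (ρ s)) × F ≡ galaxy A B ρ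

data N⁻ : Set where
  minus1 : N⁻
  nat    : ℕ → N⁻

-- intended for m ≥ 1
flower : ℕ → N⁻ → Frame
flower m minus1  = record { W = Fin m ; R = λ _ _ → ⊤ }
flower m (nat n) = record { W = Fin (suc (m + n)) ; R = λ i j →
  (toℕ i ≡ 0 × 1 ≤ toℕ j × toℕ j ≤ m) ⊎ (1 ≤ toℕ i × 1 ≤ toℕ j) }

InS : (Fm → Set) → ℕ → N⁻ → Set₁
InS L m n = Validates (flower m n) L

{-# OPTIONS --safe #-}
-- Every frame of 𝒦₂ validates L.  Fix φ ∈ L, a valuation on a galaxy and a point w.  Pick a
-- point s of A with successors b₁, b₂, and finitely many points of B: one refuting ψ for each
-- subformula □ψ of φ that fails somewhere in B (plus w itself if w ∈ B).  The flower 𝓕₂ⁿ on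
-- s, b₁, b₂ and these n points maps into the galaxy so that truth of the subformulas of φ is
-- preserved; as the flower validates L, φ holds at w.
module Submission where

open import Defs
open import Level using (0ℓ; lift)
open import Axiom.ExcludedMiddle using (ExcludedMiddle)
open import Data.Product using (Σ; _×_; _,_)
open import Data.Sum using (_⊎_; inj₁; inj₂)
open import Data.Sum.Function.Propositional using (_⊎-⇔_)
open import Data.Nat using (ℕ; s≤s; z≤n)
open import Data.Fin using () renaming (zero to fz; suc to fs)
open import Data.List using (List; []; _∷_; _++_; length; lookup)
open import Data.List.Relation.Unary.Any using (Any; here; there; index)
open import Data.List.Relation.Unary.Any.Properties using (++⁺ˡ; ++⁺ʳ; lookup-index)
open import Data.List.Membership.Propositional using (_∈_)
open import Data.List.Membership.Propositional.Properties using (∈-++⁺ˡ; ∈-++⁺ʳ)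
open import Data.Unit using (tt)
open import Function using (_∘_)
open import Function.Bundles using (_⇔_; mk⇔; Equivalence; Injection)
open import Function.Construct.Identity using (⇔-id)
open import Function.Related.TypeIsomorphisms using (¬-cong-⇔)
open import Relation.Nullary using (¬_; Dec; yes; no; contradiction)
open import Relation.Nullary.Decidable using (decidable-stable)
open import Relation.Binary.PropositionalEquality using (_≡_; refl)

boxed : Fm → List Fm
boxed (var i)  = []
boxed ⊥ₘ       = []
boxed (¬ₘ φ)   = boxed φ
boxed (φ ∨ₘ ψ) = boxed φ ++ boxed ψ
boxed (□ φ)    = φ ∷ boxed φ

module _ {X : Set} {Q : X → Set} where

  witness : Dec (Σ X Q) → List X
  witness (yes (x , _)) = x ∷ []
  witness (no _)        = []

  witness-complete : (d : Dec (Σ X Q)) → Σ X Q → Any Q (witness d)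
  witness-complete (yes (_ , q)) _  = here q
  witness-complete (no ∄q)       ∃q = contradiction ∃q ∄q

module _ (em : ExcludedMiddle 0ℓ) {I X : Set} (P : I → X → Set) where

  witnesses : List I → List X
  witnesses []       = []
  witnesses (i ∷ is) = witness {Q = P i} em ++ witnesses is

  witnesses-complete : ∀ {i is} → i ∈ is → Σ X (P i) → Any (P i) (witnesses is)
  witnesses-complete (here refl)  ∃p = ++⁺ˡ (witness-complete em ∃p)
  witnesses-complete {is = j ∷ _} (there i∈is) ∃p =
    ++⁺ʳ (witness {Q = P j} em) (witnesses-complete i∈is ∃p)

module Pullback (F G : Frame) (f : W F → W G) (V : ℕ → W G → Set) where

  pullback : ℕ → W F → Set
  pullback i = V i ∘ f

  -- The back condition of a p-morphism, weakened to successors refuting ψ.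
  Back : Fm → Set
  Back ψ = ∀ x v → R G (f x) v → ¬ Sat G V v ψ →
           Σ (W F) λ y → R F x y × ¬ Sat G V (f y) ψ

  sat-pullback : ExcludedMiddle 0ℓ → (∀ {x y} → R F x y → R G (f x) (f y)) →
                 ∀ φ → (∀ {ψ} → ψ ∈ boxed φ → Back ψ) →
                 ∀ x → Sat F pullback x φ ⇔ Sat G V (f x) φ
  sat-pullback em forth (var i)  back x = ⇔-id _
  sat-pullback em forth ⊥ₘ       back x = ⇔-id _
  sat-pullback em forth (¬ₘ φ)   back x = ¬-cong-⇔ (sat-pullback em forth φ back x)
  sat-pullback em forth (φ ∨ₘ ψ) back x =
    sat-pullback em forth φ (back ∘ ∈-++⁺ˡ) x
      ⊎-⇔ sat-pullback em forth ψ (back ∘ ∈-++⁺ʳ (boxed φ)) x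
  sat-pullback em forth (□ φ)    back x = mk⇔ to from
    where
    ih : ∀ y → Sat F pullback y φ ⇔ Sat G V (f y) φ
    ih = sat-pullback em forth φ (back ∘ there)

    to : Sat F pullback x (□ φ) → Sat G V (f x) (□ φ)
    to □φ v fx→v = decidable-stable em λ ¬φv →
      let (y , x→y , ¬φfy) = back (here refl) x v fx→v ¬φv
      in ¬φfy (Equivalence.to (ih y) (□φ y x→y))

    from : Sat G V (f x) (□ φ) → Sat F pullback x (□ φ)
    from □φ y x→y = Equivalence.from (ih y) (□φ (f y) (forth x→y))

module _ {A B : Set} (ρ : A → B → Set) (V : ℕ → A ⊎ B → Set) where

  Refutes : Fm → B → Set
  Refutes ψ b = ¬ Sat (galaxy A B ρ) V (inj₂ b) ψ

  module FlowerEmbedding (s : A) (b₁ b₂ : B) (s→b₁ : ρ s b₁) (s→b₂ : ρ s b₂)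
                         (s→b₁∣b₂ : ∀ b → ρ s b → b ≡ b₁ ⊎ b ≡ b₂) (rest : List B) where

    petals : List B
    petals = b₁ ∷ b₂ ∷ rest

    Flower : Frame
    Flower = flower 2 (nat (length rest))

    embed : W Flower → A ⊎ B
    embed fz     = inj₁ s
    embed (fs k) = inj₂ (lookup petals k)

    open Pullback Flower (galaxy A B ρ) embed V

    Covered : Fm → Set
    Covered ψ = Σ B (Refutes ψ) → Any (Refutes ψ) petals

    embed-forth : ∀ {x y} → R Flower x y → R (galaxy A B ρ) (embed x) (embed y)
    embed-forth {fz}   {fz}              (inj₁ (_ , () , _))
    embed-forth {fz}   {fz}              (inj₂ (() , _))
    embed-forth {fz}   {fs fz}           _ = s→b₁
    embed-forth {fz}   {fs (fs fz)}      _ = s→b₂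
    embed-forth {fz}   {fs (fs (fs _))}  (inj₁ (_ , _ , s≤s (s≤s ())))
    embed-forth {fz}   {fs (fs (fs _))}  (inj₂ (() , _))
    embed-forth {fs _} {fz}              (inj₁ (() , _))
    embed-forth {fs _} {fz}              (inj₂ (_ , ()))
    embed-forth {fs _} {fs _}            _ = tt

    embed-back : ∀ ψ → Covered ψ → Back ψ
    embed-back ψ covered fz     (inj₂ b) s→b ¬ψb with s→b₁∣b₂ b s→b
    ... | inj₁ refl = fs fz , inj₁ (refl , s≤s z≤n , s≤s z≤n) , ¬ψb
    ... | inj₂ refl = fs (fs fz) , inj₁ (refl , s≤s z≤n , s≤s (s≤s z≤n)) , ¬ψb
    embed-back ψ covered (fs k) (inj₂ b) _   ¬ψb =
      let refuter = covered (b , ¬ψb)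
      in fs (index refuter) , inj₂ (s≤s z≤n , s≤s z≤n) , lookup-index refuter

    sat-embed : ExcludedMiddle 0ℓ → ∀ φ → Valid Flower φ →
                (∀ {ψ} → ψ ∈ boxed φ → Covered ψ) →
                ∀ x → Sat (galaxy A B ρ) V (embed x) φ
    sat-embed em φ ⊨φ covered x =
      Equivalence.to (sat-pullback em embed-forth φ (λ {ψ} → embed-back ψ ∘ covered) x)
                     (⊨φ pullback x)

galaxy-validates : ExcludedMiddle 0ℓ → (L : Fm → Set) → (∀ n → InS L 2 (nat n)) →
                   {A B : Set} {ρ : A → B → Set} → A → (∀ s → ExactlyTwo (ρ s)) →
                   Validates (galaxy A B ρ) L
galaxy-validates em L flowers {ρ = ρ} a two φ Lφ V (inj₁ s) with two s
... | b₁ , b₂ , _ , s→b₁ , s→b₂ , s→b₁∣b₂ =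
  sat-embed em φ (flowers _ φ Lφ)
            (λ ψ∈ → there ∘ there ∘ witnesses-complete em (Refutes ρ V) ψ∈) fz
  where
  open FlowerEmbedding ρ V s b₁ b₂ s→b₁ s→b₂ s→b₁∣b₂ (witnesses em (Refutes ρ V) (boxed φ))
galaxy-validates em L flowers {ρ = ρ} a two φ Lφ V (inj₂ b) with two a
... | b₁ , b₂ , _ , a→b₁ , a→b₂ , a→b₁∣b₂ =
  sat-embed em φ (flowers _ φ Lφ)
            (λ ψ∈ → there ∘ there ∘ there ∘ witnesses-complete em (Refutes ρ V) ψ∈)
            (fs (fs (fs fz)))
  where
  open FlowerEmbedding ρ V a b₁ b₂ a→b₁ a→b₂ a→b₁∣b₂ (b ∷ witnesses em (Refutes ρ V) (boxed φ))

lemma40 : ExcludedMiddle 0ℓ →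
    (L : Fm → Set) → EuclideanLogic L →
    (∀ (n : N⁻) → InS L 2 n) →
    ∀ (σ : Sentence) → Th (Fr L) σ → Th K₂ σ
lemma40 em L _ flowers _ ⊨σ .(galaxy A B ρ) (A , B , ρ , A≥4 , _ , two , refl) =
  ⊨σ (galaxy A B ρ) (lift (inj₁ a) , galaxy-validates em L (flowers ∘ nat) a two)
  where
  a : A
  a = Injection.to A≥4 fz
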